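{- Let $p\geq 5$ be an odd prime with $p \equiv 3 \pmod{4}$ and write $p-1=2r$ with $r>1$ odd; let $m:=\operatorname{ord}_r(2)$. Then the following are equivalent: (i) $2p \in S_k$ for at least one $k\ge 0$; (ii) $-1 \in \langle 2\rangle$ in $(\mathbb{Z}/r\mathbb{Z})^\times$; (iii) there exists $t_0\ge 1$ with $2^{t_0}\equiv -1 \pmod r$, and for the least such $t_0$ we have $m=2t_0$. When any one of (i)–(iii) holds, the set of all $k\ge 0$ with $2p\in S_k$ is the infinite arithmetic progression of $k\ge 0$ with $k \equiv t_0-1 \pmod{2t_0}$, where $t_0$ is the least positive integer with $2^{t_0}\equiv -1\pmod r$; equivalently, $k \equiv \frac{m}{2}-1 \pmod m$.
   Context: For integers $k\ge 0$ and $n\ge 1$, $\sigma_k(n)=\sum_{d\mid n} d^k$ and $\phi(n)$ is Euler's totient function. For each $k\geq 0$, $S_k$ denotes the set of composite positive integers $n$ satisfying $n\cdot\sigma_k(n)\equiv 2 \pmod{\phi(n)}$. $\operatorname{ord}_r(2)$ is the multiplicative order of $2$ modulo $r$, and $\langle 2\rangle$ is the subgroup of $(\mathbb{Z}/r\mathbb{Z})^\times$ generated by $2$. -}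

module Defs where

open import Data.Nat using (ℕ; zero; suc; _+_; _*_; _∸_; _^_; _≤_; _<_)
open import Data.Nat.GCD using (gcd)
open import Data.Nat.Divisibility using (_∣?_)
open import Data.Nat.Primality using (Composite)
open import Data.List using (List; map; filter; length; upTo)
open import Data.Nat.ListAction using (sum)
open import Data.Integer as ℤ using (ℤ; +_; -[1+_])
open import Data.Integer.Divisibility as ℤD using ()
open import Data.Product using (_×_; Σ)
open import Relation.Binary.PropositionalEquality using (_≡_)
open import Relation.Nullary using (¬_)

-- a ≡ b (mod m) over ℤ: m divides a - b  (m = 0 allowed, meaning equality)
_≡_[mod_] : ℤ → ℤ → ℕ → Set
a ≡ b [mod m ] = (+ m) ℤD.∣ (a ℤ.- b)

oneTo : ℕ → List ℕ
oneTo n = map suc (upTo n)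

divisors : ℕ → List ℕ
divisors n = filter (λ d → d ∣? n) (oneTo n)

σ : ℕ → ℕ → ℕ
σ k n = sum (map (λ d → d ^ k) (divisors n))

φ : ℕ → ℕ
φ n = length (filter (λ i → Data.Nat._≟_ (gcd i n) 1) (oneTo n))

InS : ℕ → ℕ → Set
InS k n = Composite n × ((+ (n * σ k n)) ≡ (+ 2) [mod φ n ])

IsOrd2 : ℕ → ℕ → Set
IsOrd2 r m = (1 ≤ m) × ((+ (2 ^ m)) ≡ (+ 1) [mod r ])
           × (∀ j → 1 ≤ j → j < m → ¬ ((+ (2 ^ j)) ≡ (+ 1) [mod r ]))

MinusOneInPowersOf2 : ℕ → Set
MinusOneInPowersOf2 r = Σ ℕ λ j → (+ (2 ^ j)) ≡ -[1+ 0 ] [mod r ]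

IsLeastNegPow : ℕ → ℕ → Set
IsLeastNegPow r t0 = (1 ≤ t0) × ((+ (2 ^ t0)) ≡ -[1+ 0 ] [mod r ])
           × (∀ t → 1 ≤ t → t < t0 → ¬ ((+ (2 ^ t)) ≡ -[1+ 0 ] [mod r ]))

{-# OPTIONS --safe #-}
-- φ(2p) = p − 1 = 2r and σ_k(2p) = 1 + 2^k + p^k + (2p)^k. As p ≡ 1 (mod r), the condition
-- 2p·σ_k(2p) ≡ 2 (mod 2r) says p·σ_k(2p) ≡ 1, i.e. 2 + 2^(k+1) ≡ 1, i.e. 2^(k+1) ≡ −1 (mod r).
-- Everything else is about powers of 2 modulo r > 2: if t0 is least with 2^t0 ≡ −1, then
-- 2^j ≡ −1 exactly when j ≡ t0 modulo the order m of 2, and m = 2·t0, because 2^(2·t0) ≡ 1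
-- while m ≤ t0 or t0 < m < 2·t0 would produce some d < t0 with 2^d ≡ −1.
module Submission where

open import Defs
open import Data.Nat using (ℕ; _+_; _*_; _∸_; _%_; _≤_; _<_; ⌊_/2⌋)
open import Data.Nat.Primality using (Prime)
open import Data.Integer using (+_)
open import Data.Product using (_×_; Σ)
open import Function.Bundles using (_⇔_)
open import Relation.Binary.PropositionalEquality using (_≡_)

open import Data.Nat as ℕ using (zero; suc; _^_; _≤′_; z≤n; s≤s; NonZero)
import Data.Nat.Properties as ℕ
open import Data.Nat.DivMod using (_/_; m≡m%n+[m/n]*n; m%n<n)
open import Data.Nat.Divisibility as ℕ using (_∣_; _∣?_; divides; m%n≡0⇒n∣m)
open import Data.Nat.GCD using (gcd; gcd[m,n]∣m; gcd[m,n]∣n; gcd-greatest)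
open import Data.Nat.Coprimality using (gcd≡1⇒coprime; coprime-divisor)
open import Data.Nat.Primality
  using (Composite; prime⇒irreducible; prime⇒nonZero; irreducible[2]; composite-≢; ¬prime[1])
open import Data.Nat.ListAction using (sum)
open import Data.Nat.Tactic.RingSolver using (solve-∀)
open import Data.Integer as ℤ using (ℤ; -[1+_])
import Data.Integer.Properties as ℤ
open import Data.Integer.Divisibility.Signed as ℤ∣ using (∣ᵤ⇒∣; ∣⇒∣ᵤ)
import Data.Integer.Tactic.RingSolver as ℤ-Solver
open import Data.List using ([]; _∷_; _∷ʳ_; _++_; [_]; map; filter; length; upTo)
import Data.List.Properties as List
open import Data.Product using (_,_; proj₁; proj₂)
open import Data.Sum using (_⊎_; inj₁; inj₂; [_,_]′)
open import Data.Empty using (⊥-elim)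
open import Function using (_∘_; _∘′_)
open import Function.Bundles using (mk⇔; Equivalence)
open import Function.Properties.Equivalence using (⇔-setoid)
open import Level using (0ℓ)
open import Relation.Binary.Bundles using (Setoid)
open import Relation.Binary.Definitions using (tri<; tri≈; tri>)
open import Relation.Binary.PropositionalEquality
  using (_≢_; refl; sym; trans; cong; subst; subst₂; module ≡-Reasoning)
open import Relation.Nullary using (¬_; Dec; yes; no)
open import Relation.Unary using (Pred; Decidable)

-- A copy of _≡_[mod_] as a record: the Defs relation unfolds to divisibility of ∣ a - b ∣,
-- from which unification cannot recover a and b, so they could never be left implicit.
infix 4 _≈_[mod_]

record _≈_[mod_] (a b : ℤ) (n : ℕ) : Set where
  constructor mod
  field divides-difference : (+ n) ℤ∣.∣ (a ℤ.- b)


≈⇒≡[mod] : ∀ {a b n} → a ≈ b [mod n ] → a ≡ b [mod n ]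
≈⇒≡[mod] (mod n∣a-b) = ∣⇒∣ᵤ n∣a-b

≡⇒≈[mod] : ∀ {a b n} → a ≡ b [mod n ] → a ≈ b [mod n ]
≡⇒≈[mod] n∣a-b = mod (∣ᵤ⇒∣ n∣a-b)

_≡?_[mod_] : ∀ a b n → Dec (a ≡ b [mod n ])
a ≡? b [mod n ] = n ℕ.∣? ℤ.∣ a ℤ.- b ∣

≈⇔≡[mod] : ∀ {a b n} → a ≈ b [mod n ] ⇔ a ≡ b [mod n ]
≈⇔≡[mod] = mk⇔ ≈⇒≡[mod] ≡⇒≈[mod]

≈-refl : ∀ {a n} → a ≈ a [mod n ]
≈-refl {a} {n} = mod (subst ((+ n) ℤ∣.∣_) (sym (ℤ.+-inverseʳ a)) (∣ᵤ⇒∣ (n ℕ.∣0)))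

≈-sym : ∀ {a b n} → a ≈ b [mod n ] → b ≈ a [mod n ]
≈-sym {a} {b} (mod n∣a-b) = mod (subst (_ ℤ∣.∣_) (identity a b) (ℤ∣.∣m⇒∣-m n∣a-b))
  where
  identity : ∀ a b → ℤ.- (a ℤ.- b) ≡ b ℤ.- a
  identity = ℤ-Solver.solve-∀

≈-trans : ∀ {a b c n} → a ≈ b [mod n ] → b ≈ c [mod n ] → a ≈ c [mod n ]
≈-trans {a} {b} {c} (mod n∣a-b) (mod n∣b-c) =
  mod (subst (_ ℤ∣.∣_) (identity a b c) (ℤ∣.∣m∣n⇒∣m+n n∣a-b n∣b-c))
  where
  identity : ∀ a b c → (a ℤ.- b) ℤ.+ (b ℤ.- c) ≡ a ℤ.- c
  identity = ℤ-Solver.solve-∀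

≈-setoid : ℕ → Setoid _ _
≈-setoid n = record
  { Carrier = ℤ
  ; _≈_ = _≈_[mod n ]
  ; isEquivalence = record { refl = ≈-refl ; sym = ≈-sym ; trans = ≈-trans }
  }

+-cong-mod : ∀ {a b c d n} → a ≈ b [mod n ] → c ≈ d [mod n ] → a ℤ.+ c ≈ b ℤ.+ d [mod n ]
+-cong-mod {a} {b} {c} {d} (mod n∣a-b) (mod n∣c-d) =
  mod (subst (_ ℤ∣.∣_) (identity a b c d) (ℤ∣.∣m∣n⇒∣m+n n∣a-b n∣c-d))
  where
  identity : ∀ a b c d → (a ℤ.- b) ℤ.+ (c ℤ.- d) ≡ (a ℤ.+ c) ℤ.- (b ℤ.+ d)
  identity = ℤ-Solver.solve-∀

*-cong-mod : ∀ {a b c d n} → a ≈ b [mod n ] → c ≈ d [mod n ] → a ℤ.* c ≈ b ℤ.* d [mod n ]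
*-cong-mod {a} {b} {c} {d} (mod n∣a-b) (mod n∣c-d) =
  mod (subst (_ ℤ∣.∣_) (identity a b c d) (ℤ∣.∣m∣n⇒∣m+n (ℤ∣.∣m⇒∣m*n c n∣a-b) (ℤ∣.∣n⇒∣m*n b n∣c-d)))
  where
  identity : ∀ a b c d → (a ℤ.- b) ℤ.* c ℤ.+ b ℤ.* (c ℤ.- d) ≡ a ℤ.* c ℤ.- b ℤ.* d
  identity = ℤ-Solver.solve-∀

neg-cong-mod : ∀ {a b n} → a ≈ b [mod n ] → ℤ.- a ≈ ℤ.- b [mod n ]
neg-cong-mod {a} {b} (mod n∣a-b) = mod (subst (_ ℤ∣.∣_) (identity a b) (ℤ∣.∣m⇒∣-m n∣a-b))
  where
  identity : ∀ a b → ℤ.- (a ℤ.- b) ≡ ℤ.- a ℤ.- ℤ.- b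
  identity = ℤ-Solver.solve-∀

neg-swap-mod : ∀ {a b n} → ℤ.- a ≈ b [mod n ] → a ≈ ℤ.- b [mod n ]
neg-swap-mod {a} {b} {n} -a≈b = subst (_≈ ℤ.- b [mod n ]) (ℤ.neg-involutive a) (neg-cong-mod -a≈b)

pos-+-cong-mod : ∀ {x y u v n} → + x ≈ + y [mod n ] → + u ≈ + v [mod n ]
               → + (x + u) ≈ + (y + v) [mod n ]
pos-+-cong-mod {x} {y} {u} {v} {n} x≈y u≈v =
  subst₂ (λ a b → a ≈ b [mod n ]) (sym (ℤ.pos-+ x u)) (sym (ℤ.pos-+ y v)) (+-cong-mod x≈y u≈v)

pos-*-cong-mod : ∀ {x y u v n} → + x ≈ + y [mod n ] → + u ≈ + v [mod n ]
               → + (x * u) ≈ + (y * v) [mod n ]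
pos-*-cong-mod {x} {y} {u} {v} {n} x≈y u≈v =
  subst₂ (λ a b → a ≈ b [mod n ]) (sym (ℤ.pos-* x u)) (sym (ℤ.pos-* y v)) (*-cong-mod x≈y u≈v)

^-cong-mod : ∀ {x y n} k → + x ≈ + y [mod n ] → + (x ^ k) ≈ + (y ^ k) [mod n ]
^-cong-mod zero    x≈y = ≈-refl
^-cong-mod (suc k) x≈y = pos-*-cong-mod x≈y (^-cong-mod k x≈y)

+-cancelˡ-mod : ∀ c {a b n} → c ℤ.+ a ≈ c ℤ.+ b [mod n ] → a ≈ b [mod n ]
+-cancelˡ-mod c {a} {b} (mod n∣difference) = mod (subst (_ ℤ∣.∣_) (identity c a b) n∣difference)
  where
  identity : ∀ c a b → (c ℤ.+ a) ℤ.- (c ℤ.+ b) ≡ a ℤ.- b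
  identity = ℤ-Solver.solve-∀

+-cancelˡ-mod⇔ : ∀ c {a b n} → c ℤ.+ a ≈ c ℤ.+ b [mod n ] ⇔ a ≈ b [mod n ]
+-cancelˡ-mod⇔ c = mk⇔ (+-cancelˡ-mod c) (+-cong-mod (≈-refl {c}))

*-cancelˡ-mod : ∀ k {a b n} .{{_ : NonZero k}} → + k ℤ.* a ≈ + k ℤ.* b [mod k * n ] → a ≈ b [mod n ]
*-cancelˡ-mod k {a} {b} {n} (mod kn∣difference) =
  mod (ℤ∣.*-cancelˡ-∣ (+ k) (subst₂ ℤ∣._∣_ (ℤ.pos-* k n) (identity (+ k) a b) kn∣difference))
  where
  identity : ∀ k a b → k ℤ.* a ℤ.- k ℤ.* b ≡ k ℤ.* (a ℤ.- b)
  identity = ℤ-Solver.solve-∀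

*-monoˡ-mod : ∀ k {a b n} → a ≈ b [mod n ] → + k ℤ.* a ≈ + k ℤ.* b [mod k * n ]
*-monoˡ-mod k {a} {b} {n} (mod n∣a-b) =
  mod (subst₂ ℤ∣._∣_ (sym (ℤ.pos-* k n)) (identity (+ k) a b) (ℤ∣.*-monoʳ-∣ (+ k) n∣a-b))
  where
  identity : ∀ k a b → k ℤ.* (a ℤ.- b) ≡ k ℤ.* a ℤ.- k ℤ.* b
  identity = ℤ-Solver.solve-∀

1≉-1[mod] : ∀ {n} → 2 < n → ¬ + 1 ≈ -[1+ 0 ] [mod n ]
1≉-1[mod] 2<n (mod n∣2) = ℕ.<⇒≱ 2<n (ℕ.∣⇒≤ (∣⇒∣ᵤ n∣2))

+[i+d]≈+i[mod]⇔∣ : ∀ {m} i d → + (i + d) ≈ + i [mod m ] ⇔ m ∣ d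
+[i+d]≈+i[mod]⇔∣ {m} i d = mk⇔
  (λ (mod m∣difference) → ∣⇒∣ᵤ (subst ((+ m) ℤ∣.∣_) difference m∣difference))
  (λ m∣d → mod (subst ((+ m) ℤ∣.∣_) (sym difference) (∣ᵤ⇒∣ m∣d)))
  where
  identity : ∀ i d → (i ℤ.+ d) ℤ.- i ≡ d
  identity = ℤ-Solver.solve-∀
  difference : + (i + d) ℤ.- + i ≡ + d
  difference = trans (cong (ℤ._- + i) (ℤ.pos-+ i d)) (identity (+ i) (+ d))

IsOrder : ℕ → ℕ → ℕ → Set
IsOrder a r m = (1 ≤ m) × ((+ (a ^ m)) ≡ (+ 1) [mod r ])
              × (∀ j → 1 ≤ j → j < m → ¬ ((+ (a ^ j)) ≡ (+ 1) [mod r ]))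

IsLeastNegativePower : ℕ → ℕ → ℕ → Set
IsLeastNegativePower a r t = (1 ≤ t) × ((+ (a ^ t)) ≡ -[1+ 0 ] [mod r ])
                           × (∀ s → 1 ≤ s → s < t → ¬ ((+ (a ^ s)) ≡ -[1+ 0 ] [mod r ]))

module Powers (a r : ℕ) where

  open import Relation.Binary.Reasoning.Setoid (≈-setoid r)

  pow : ℕ → ℤ
  pow j = + (a ^ j)

  pow-+ : ∀ i j → pow (i + j) ≡ pow i ℤ.* pow j
  pow-+ i j = trans (cong +_ (ℕ.^-distribˡ-+-* a i j)) (ℤ.pos-* (a ^ i) (a ^ j))

  pow-+-shift : ∀ {c} i j → pow i ≈ c [mod r ] → pow (i + j) ≈ c ℤ.* pow j [mod r ]
  pow-+-shift {c} i j aⁱ≈c = begin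
    pow (i + j)        ≡⟨ pow-+ i j ⟩
    pow i ℤ.* pow j    ≈⟨ *-cong-mod aⁱ≈c ≈-refl ⟩
    c ℤ.* pow j        ∎

  pow-+-period : ∀ i {d} → pow d ≈ + 1 [mod r ] → pow (i + d) ≈ pow i [mod r ]
  pow-+-period i {d} aᵈ≈1 = begin
    pow (i + d)        ≡⟨ cong pow (ℕ.+-comm i d) ⟩
    pow (d + i)        ≈⟨ pow-+-shift d i aᵈ≈1 ⟩
    + 1 ℤ.* pow i      ≡⟨ ℤ.*-identityˡ (pow i) ⟩
    pow i              ∎

  pow-+-antiperiod : ∀ i j → pow i ≈ -[1+ 0 ] [mod r ] → pow (i + j) ≈ ℤ.- pow j [mod r ]
  pow-+-antiperiod i j aⁱ≈-1 = begin
    pow (i + j)          ≈⟨ pow-+-shift i j aⁱ≈-1 ⟩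
    -[1+ 0 ] ℤ.* pow j   ≡⟨ ℤ.-1*i≡-i (pow j) ⟩
    ℤ.- pow j            ∎

  module Order {m} (ord : IsOrder a r m) where

    private instance
      m-nonZero : NonZero m
      m-nonZero = ℕ.>-nonZero (proj₁ ord)

    pow-ord≈1 : pow m ≈ + 1 [mod r ]
    pow-ord≈1 = ≡⇒≈[mod] (proj₁ (proj₂ ord))

    pow[q*ord]≈1 : ∀ q → pow (q * m) ≈ + 1 [mod r ]
    pow[q*ord]≈1 zero    = ≈-refl
    pow[q*ord]≈1 (suc q) = begin
      pow (m + q * m)    ≈⟨ pow-+-period m (pow[q*ord]≈1 q) ⟩
      pow m              ≈⟨ pow-ord≈1 ⟩
      + 1                ∎

    ord∣⇒pow≈1 : ∀ {j} → m ∣ j → pow j ≈ + 1 [mod r ]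
    ord∣⇒pow≈1 (divides q refl) = pow[q*ord]≈1 q

    pow≈1⇒ord∣ : ∀ {j} → pow j ≈ + 1 [mod r ] → m ∣ j
    pow≈1⇒ord∣ {j} aʲ≈1 with j % m in j%m≡s
    ... | zero  = m%n≡0⇒n∣m j m j%m≡s
    ... | suc s = ⊥-elim (proj₂ (proj₂ ord) (suc s) (s≤s z≤n) (subst (_< m) j%m≡s (m%n<n j m))
                                               (≈⇒≡[mod] aˢ⁺¹≈1))
      where
      aˢ⁺¹≈1 : pow (suc s) ≈ + 1 [mod r ]
      aˢ⁺¹≈1 = begin
        pow (suc s)                ≈⟨ ≈-sym (pow-+-period (suc s) (pow[q*ord]≈1 (j / m))) ⟩
        pow (suc s + j / m * m)    ≡⟨ cong (λ e → pow (e + j / m * m)) j%m≡s ⟨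
        pow (j % m + j / m * m)    ≡⟨ cong pow (m≡m%n+[m/n]*n j m) ⟨
        pow j                      ≈⟨ aʲ≈1 ⟩
        + 1                        ∎

    pow-+-ord∣ : ∀ i {d} → m ∣ d → pow (i + d) ≈ pow i [mod r ]
    pow-+-ord∣ i m∣d = pow-+-period i (ord∣⇒pow≈1 m∣d)

    pow-cong-ord : ∀ {i j} → + i ≈ + j [mod m ] → pow i ≈ pow j [mod r ]
    pow-cong-ord {i} {j} i≈j with ℕ.≤-total i j
    ... | inj₁ i≤j with ℕ.m≤n⇒∃[o]m+o≡n i≤j
    ...   | d , refl = ≈-sym (pow-+-ord∣ i (Equivalence.to (+[i+d]≈+i[mod]⇔∣ i d) (≈-sym i≈j)))
    pow-cong-ord {i} {j} i≈j | inj₂ j≤i with ℕ.m≤n⇒∃[o]m+o≡n j≤i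
    ...   | d , refl = pow-+-ord∣ j (Equivalence.to (+[i+d]≈+i[mod]⇔∣ j d) i≈j)

    module LeastNegativePower (2<r : 2 < r) {t} (least : IsLeastNegativePower a r t) where

      pow-t≈-1 : pow t ≈ -[1+ 0 ] [mod r ]
      pow-t≈-1 = ≡⇒≈[mod] (proj₁ (proj₂ least))

      pow≉-1-below : ∀ {j} → j < t → ¬ pow j ≈ -[1+ 0 ] [mod r ]
      pow≉-1-below {zero}  _   = 1≉-1[mod] 2<r
      pow≉-1-below {suc j} j<t = proj₂ (proj₂ least) (suc j) (s≤s z≤n) j<t ∘ ≈⇒≡[mod]

      pow≈-1⇒≈t : ∀ {j} → pow j ≈ -[1+ 0 ] [mod r ] → + j ≈ + t [mod m ]
      pow≈-1⇒≈t {j} aʲ≈-1 with ℕ.m≤n⇒∃[o]m+o≡n {n = j} (ℕ.≮⇒≥ (λ j<t → pow≉-1-below j<t aʲ≈-1))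
      ... | d , refl = Equivalence.from (+[i+d]≈+i[mod]⇔∣ t d) (pow≈1⇒ord∣ (neg-swap-mod (begin
        ℤ.- pow d     ≈⟨ pow-+-antiperiod t d pow-t≈-1 ⟨
        pow (t + d)   ≈⟨ aʲ≈-1 ⟩
        -[1+ 0 ]      ∎)))

      pow≈-1⇔≈t : ∀ {j} → pow j ≈ -[1+ 0 ] [mod r ] ⇔ + j ≈ + t [mod m ]
      pow≈-1⇔≈t = mk⇔ pow≈-1⇒≈t (λ j≈t → ≈-trans (pow-cong-ord j≈t) pow-t≈-1)

      pow[t+t]≈1 : pow (t + t) ≈ + 1 [mod r ]
      pow[t+t]≈1 = ≈-trans (pow-+-antiperiod t t pow-t≈-1) (neg-cong-mod pow-t≈-1)

      ord≡2*t : m ≡ 2 * t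
      ord≡2*t with ℕ.<-cmp m (t + t)
      ... | tri≈ _ m≡t+t _ = trans m≡t+t (cong (λ x → t + x) (sym (ℕ.+-identityʳ t)))
      ... | tri> _ _ t+t<m = ⊥-elim (proj₂ (proj₂ ord) (t + t) (ℕ.≤-trans (proj₁ least) (ℕ.m≤m+n t t)) t+t<m
                                       (≈⇒≡[mod] pow[t+t]≈1))
      ... | tri< m<t+t _ _ with ℕ.≤-total m t
      ...   | inj₁ m≤t with ℕ.m≤n⇒∃[o]m+o≡n m≤t
      ...     | d , m+d≡t = ⊥-elim (pow≉-1-below d<t (begin
                  pow d         ≈⟨ pow-+-period d pow-ord≈1 ⟨
                  pow (d + m)   ≡⟨ cong pow (trans (ℕ.+-comm d m) m+d≡t) ⟩
                  pow t         ≈⟨ pow-t≈-1 ⟩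
                  -[1+ 0 ]      ∎))
        where
        d<t : d < t
        d<t = subst (d <_) m+d≡t (ℕ.m<n+m d (proj₁ ord))
      ord≡2*t | tri< m<t+t _ _ | inj₂ t≤m with ℕ.m≤n⇒∃[o]m+o≡n t≤m
      ...     | d , t+d≡m = ⊥-elim (pow≉-1-below d<t (neg-swap-mod (begin
                  ℤ.- pow d     ≈⟨ pow-+-antiperiod t d pow-t≈-1 ⟨
                  pow (t + d)   ≡⟨ cong pow t+d≡m ⟩
                  pow m         ≈⟨ pow-ord≈1 ⟩
                  + 1           ∎)))
        where
        d<t : d < t
        d<t = ℕ.+-cancelˡ-< t d t (subst (_< t + t) (sym t+d≡m) m<t+t)

module _ {P : Pred ℕ 0ℓ} (P? : Decidable P) where

  least-below⊎none-below : ∀ b → (Σ ℕ λ t → P t × (∀ {j} → j < t → ¬ P j)) ⊎ (∀ {j} → j < b → ¬ P j)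
  least-below⊎none-below zero = inj₂ λ ()
  least-below⊎none-below (suc b) with least-below⊎none-below b
  ... | inj₁ least = inj₁ least
  ... | inj₂ none with P? b
  ...   | yes Pb = inj₁ (b , Pb , none)
  ...   | no ¬Pb = inj₂ (λ j<1+b → [ none , (λ { refl → ¬Pb }) ]′ (ℕ.m<1+n⇒m<n∨m≡n j<1+b))

  least-witness : ∀ {n} → P n → Σ ℕ λ t → P t × (∀ {j} → j < t → ¬ P j)
  least-witness {n} Pn with least-below⊎none-below (suc n)
  ... | inj₁ least = least
  ... | inj₂ none  = ⊥-elim (none (ℕ.n<1+n n) Pn)

  filter-oneTo-suc : ∀ n → filter P? (oneTo (suc n)) ≡ filter P? (oneTo n) ++ filter P? [ suc n ]
  filter-oneTo-suc n = begin
    filter P? (map suc (upTo (suc n)))              ≡⟨ cong (filter P? ∘′ map suc) (List.upTo-∷ʳ n) ⟨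
    filter P? (map suc (upTo n ++ [ n ]))           ≡⟨ cong (filter P?) (List.map-++ suc (upTo n) [ n ]) ⟩
    filter P? (oneTo n ++ [ suc n ])                ≡⟨ List.filter-++ P? (oneTo n) [ suc n ] ⟩
    filter P? (oneTo n) ++ filter P? [ suc n ]      ∎
    where open ≡-Reasoning

  filter-oneTo-accept : ∀ {n} → P (suc n) → filter P? (oneTo (suc n)) ≡ filter P? (oneTo n) ∷ʳ suc n
  filter-oneTo-accept {n} Pn+1 = trans (filter-oneTo-suc n)
    (cong (filter P? (oneTo n) ++_) (List.filter-accept P? Pn+1))

  filter-oneTo-reject : ∀ {n} → ¬ P (suc n) → filter P? (oneTo (suc n)) ≡ filter P? (oneTo n)
  filter-oneTo-reject {n} ¬Pn+1 = trans (filter-oneTo-suc n)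
    (trans (cong (filter P? (oneTo n) ++_) (List.filter-reject P? ¬Pn+1)) (List.++-identityʳ _))

  filter-oneTo-gap : ∀ {a b} → a ≤ b → (∀ {i} → a < i → i ≤ b → ¬ P i)
                   → filter P? (oneTo b) ≡ filter P? (oneTo a)
  filter-oneTo-gap a≤b = gap (ℕ.≤⇒≤′ a≤b)
    where
    gap : ∀ {a b} → a ≤′ b → (∀ {i} → a < i → i ≤ b → ¬ P i)
        → filter P? (oneTo b) ≡ filter P? (oneTo a)
    gap ℕ.≤′-refl         _    = refl
    gap (ℕ.≤′-step a≤′b) none = trans (filter-oneTo-reject (none (s≤s (ℕ.≤′⇒≤ a≤′b)) ℕ.≤-refl))
      (gap a≤′b (λ a<i i≤b → none a<i (ℕ.m≤n⇒m≤1+n i≤b)))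

  length-filter-oneTo-alternating : ∀ a j
    → (∀ {i} → i < j → P (suc (a + 2 * i)) × ¬ P (suc (suc (a + 2 * i))))
    → length (filter P? (oneTo (a + 2 * j))) ≡ length (filter P? (oneTo a)) + j
  length-filter-oneTo-alternating a zero    _           =
    trans (cong (length ∘′ filter P? ∘′ oneTo) (ℕ.+-identityʳ a)) (sym (ℕ.+-identityʳ _))
  length-filter-oneTo-alternating a (suc j) alternating = begin
    count (a + 2 * suc j)                      ≡⟨ cong count (identity₁ a j) ⟩
    count (suc (suc (a + 2 * j)))              ≡⟨ cong length (filter-oneTo-reject ¬P[a+2j+2]) ⟩
    count (suc (a + 2 * j))                    ≡⟨ cong length (filter-oneTo-accept P[a+2j+1]) ⟩
    length (filter P? (oneTo (a + 2 * j)) ∷ʳ suc (a + 2 * j))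
                                               ≡⟨ List.length-++ (filter P? (oneTo (a + 2 * j))) ⟩
    count (a + 2 * j) + 1                      ≡⟨ cong (_+ 1) (length-filter-oneTo-alternating a j
                                                                 (alternating ∘′ ℕ.m<n⇒m<1+n)) ⟩
    count a + j + 1                            ≡⟨ identity₂ (count a) j ⟩
    count a + suc j                            ∎
    where
    P[a+2j+1] : P (suc (a + 2 * j))
    P[a+2j+1] = proj₁ (alternating (ℕ.n<1+n j))
    ¬P[a+2j+2] : ¬ P (suc (suc (a + 2 * j)))
    ¬P[a+2j+2] = proj₂ (alternating (ℕ.n<1+n j))
    open ≡-Reasoning
    count : ℕ → ℕ
    count n = length (filter P? (oneTo n))
    identity₁ : ∀ a j → a + 2 * suc j ≡ suc (suc (a + 2 * j))
    identity₁ = solve-∀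
    identity₂ : ∀ c j → c + j + 1 ≡ c + suc j
    identity₂ = solve-∀

∣2*p⇒≡1∨≡2∨≡p∨≡2*p : ∀ {p d} → Prime p → d ∣ 2 * p → d ≡ 1 ⊎ d ≡ 2 ⊎ d ≡ p ⊎ d ≡ 2 * p
∣2*p⇒≡1∨≡2∨≡p∨≡2*p {p} {d} p-prime d∣2p with prime⇒irreducible p-prime (gcd[m,n]∣n d p)
... | inj₁ gcd≡1 with irreducible[2] (coprime-divisor (gcd≡1⇒coprime gcd≡1) (subst (d ∣_) (ℕ.*-comm 2 p) d∣2p))
...   | inj₁ d≡1 = inj₁ d≡1
...   | inj₂ d≡2 = inj₂ (inj₁ d≡2)
∣2*p⇒≡1∨≡2∨≡p∨≡2*p {p} {d} p-prime d∣2p | inj₂ gcd≡p with subst (_∣ d) gcd≡p (gcd[m,n]∣m d p)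
... | divides e refl with irreducible[2] {e} (ℕ.*-cancelʳ-∣ p {{prime⇒nonZero p-prime}} d∣2p)
...   | inj₁ refl = inj₂ (inj₂ (inj₁ (ℕ.*-identityˡ p)))
...   | inj₂ refl = inj₂ (inj₂ (inj₂ refl))

gcd≢1 : ∀ {d i n} → 1 < d → d ∣ i → d ∣ n → gcd i n ≢ 1
gcd≢1 1<d d∣i d∣n gcd≡1 = ℕ.<⇒≢ 1<d (sym (ℕ.∣1⇒≡1 (subst (_ ∣_) gcd≡1 (gcd-greatest d∣i d∣n))))

2∤1+2*n : ∀ n → ¬ 2 ∣ suc (2 * n)
2∤1+2*n n (divides q 1+2n≡q*2) = ℕ.even≢odd q n (trans (ℕ.*-comm 2 q) (sym 1+2n≡q*2))

gcd[i,2*p]≡1 : ∀ {p i} → Prime p → ¬ 2 ∣ i → ¬ p ∣ i → gcd i (2 * p) ≡ 1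
gcd[i,2*p]≡1 {p} {i} p-prime 2∤i p∤i with ∣2*p⇒≡1∨≡2∨≡p∨≡2*p p-prime (gcd[m,n]∣n i (2 * p))
... | inj₁ gcd≡1 = gcd≡1
... | inj₂ (inj₁ gcd≡2) = ⊥-elim (2∤i (subst (_∣ i) gcd≡2 (gcd[m,n]∣m i _)))
... | inj₂ (inj₂ (inj₁ gcd≡p)) = ⊥-elim (p∤i (subst (_∣ i) gcd≡p (gcd[m,n]∣m i _)))
... | inj₂ (inj₂ (inj₂ gcd≡2p)) = ⊥-elim (2∤i (ℕ.∣-trans (ℕ.m∣m*n p) (subst (_∣ i) gcd≡2p (gcd[m,n]∣m i _))))

module TwiceOddPrime {r : ℕ} (p-prime : Prime (suc (2 * r))) where

  p : ℕ
  p = suc (2 * r)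

  0<r : 0 < r
  0<r = ℕ.n≢0⇒n>0 (λ r≡0 → ¬prime[1] (subst (λ x → Prime (suc (2 * x))) r≡0 p-prime))

  2≤2*r : 2 ≤ 2 * r
  2≤2*r = ℕ.*-monoʳ-≤ 2 0<r

  2<p : 2 < p
  2<p = s≤s 2≤2*r

  1<p : 1 < p
  1<p = ℕ.<-trans (ℕ.n<1+n 1) 2<p

  2∣2*p : 2 ∣ 2 * p
  2∣2*p = ℕ.m∣m*n p

  2*p≡1+p+2*r : 2 * p ≡ suc (p + 2 * r)
  2*p≡1+p+2*r = identity r
    where
    identity : ∀ r → 2 * suc (2 * r) ≡ suc (suc (2 * r) + 2 * r)
    identity = solve-∀

  ∤2*p : ∀ {i} → i ≢ 1 → i ≢ 2 → i ≢ p → i ≢ 2 * p → ¬ i ∣ 2 * p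
  ∤2*p i≢1 i≢2 i≢p i≢2p i∣2p with ∣2*p⇒≡1∨≡2∨≡p∨≡2*p p-prime i∣2p
  ... | inj₁ i≡1                = i≢1 i≡1
  ... | inj₂ (inj₁ i≡2)         = i≢2 i≡2
  ... | inj₂ (inj₂ (inj₁ i≡p))  = i≢p i≡p
  ... | inj₂ (inj₂ (inj₂ i≡2p)) = i≢2p i≡2p

  divisors[2*p] : divisors (2 * p) ≡ 1 ∷ 2 ∷ p ∷ 2 * p ∷ []
  divisors[2*p] = begin
    filter D? (oneTo (2 * p))             ≡⟨ cong (filter D? ∘′ oneTo) 2*p≡1+p+2*r ⟩
    filter D? (oneTo (suc (p + 2 * r)))   ≡⟨ filter-oneTo-accept D? (ℕ.∣-reflexive (sym 2*p≡1+p+2*r)) ⟩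
    filter D? (oneTo (p + 2 * r)) ∷ʳ 2p   ≡⟨ cong (_∷ʳ 2p) (filter-oneTo-gap D? (ℕ.m≤m+n p (2 * r)) ∤2*p-above-p) ⟩
    filter D? (oneTo p) ∷ʳ 2p             ≡⟨ cong (_∷ʳ 2p) (filter-oneTo-accept D? (ℕ.n∣m*n 2)) ⟩
    filter D? (oneTo (2 * r)) ∷ʳ p ∷ʳ 2p  ≡⟨ cong (λ xs → xs ∷ʳ p ∷ʳ 2p) (filter-oneTo-gap D? 2≤2*r ∤2*p-above-2) ⟩
    filter D? (oneTo 2) ∷ʳ p ∷ʳ 2p        ≡⟨ cong (λ xs → xs ∷ʳ p ∷ʳ 2p) (filter-oneTo-accept D? 2∣2*p) ⟩
    filter D? (oneTo 1) ∷ʳ 2 ∷ʳ p ∷ʳ 2p   ≡⟨ cong (λ xs → xs ∷ʳ 2 ∷ʳ p ∷ʳ 2p) (filter-oneTo-accept D? (ℕ.1∣ _)) ⟩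
    1 ∷ 2 ∷ p ∷ 2p ∷ []                   ≡⟨ cong (λ x → 1 ∷ 2 ∷ p ∷ x ∷ []) (sym 2*p≡1+p+2*r) ⟩
    1 ∷ 2 ∷ p ∷ 2 * p ∷ []                ∎
    where
    open ≡-Reasoning
    D? : Decidable (_∣ 2 * p)
    D? d = d ∣? 2 * p
    2p : ℕ
    2p = suc (p + 2 * r)
    ∤2*p-above-2 : ∀ {i} → 2 < i → i ≤ 2 * r → ¬ i ∣ 2 * p
    ∤2*p-above-2 2<i i≤2r = ∤2*p (ℕ.>⇒≢ (ℕ.<-trans (ℕ.n<1+n 1) 2<i)) (ℕ.>⇒≢ 2<i) (ℕ.<⇒≢ (s≤s i≤2r))
                                 (ℕ.<⇒≢ (ℕ.<-≤-trans (s≤s i≤2r) (ℕ.m≤n*m p 2)))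
    ∤2*p-above-p : ∀ {i} → p < i → i ≤ p + 2 * r → ¬ i ∣ 2 * p
    ∤2*p-above-p {i} p<i i≤p+2r = ∤2*p (ℕ.>⇒≢ (ℕ.<-trans 1<p p<i)) (ℕ.>⇒≢ (ℕ.<-trans 2<p p<i)) (ℕ.>⇒≢ p<i)
                                       (ℕ.<⇒≢ (subst (i <_) (sym 2*p≡1+p+2*r) (s≤s i≤p+2r)))

  -- The i ∈ [1, 2p] coprime to 2p are the odd ones other than p.
  φ[2*p] : φ (2 * p) ≡ 2 * r
  φ[2*p] = begin
    count (2 * p)           ≡⟨ cong count (identity₁ r) ⟩
    count (suc p + 2 * r)   ≡⟨ length-filter-oneTo-alternating C? (suc p) r odd-coprime-above-p ⟩
    count (suc p) + r       ≡⟨ cong (λ xs → length xs + r) (filter-oneTo-reject C? (even-¬coprime 2∣1+p)) ⟩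
    count p + r             ≡⟨ cong (λ xs → length xs + r) (filter-oneTo-reject C? (gcd≢1 1<p ℕ.∣-refl (ℕ.n∣m*n 2))) ⟩
    count (2 * r) + r       ≡⟨ cong (_+ r) (length-filter-oneTo-alternating C? 0 r odd-coprime-below-p) ⟩
    r + r                   ≡⟨ cong (λ x → r + x) (ℕ.+-identityʳ r) ⟨
    2 * r                   ∎
    where
    open ≡-Reasoning
    C? : Decidable (λ i → gcd i (2 * p) ≡ 1)
    C? i = gcd i (2 * p) ℕ.≟ 1
    count : ℕ → ℕ
    count n = length (filter C? (oneTo n))
    identity₁ : ∀ r → 2 * suc (2 * r) ≡ suc (suc (2 * r)) + 2 * r
    identity₁ = solve-∀
    identity₂ : ∀ r → suc (suc (2 * r)) ≡ suc r * 2
    identity₂ = solve-∀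
    identity₃ : ∀ r i → suc (suc (suc (2 * r)) + 2 * i) ≡ suc (2 * suc (r + i))
    identity₃ = solve-∀
    identity₄ : ∀ r i → suc (suc (suc (2 * r)) + 2 * i) ≡ suc (2 * r) + suc (suc (2 * i))
    identity₄ = solve-∀
    identity₅ : ∀ r i → suc (suc (suc (suc (2 * r)) + 2 * i)) ≡ suc (suc (r + i)) * 2
    identity₅ = solve-∀
    even-¬coprime : ∀ {i} → 2 ∣ i → gcd i (2 * p) ≢ 1
    even-¬coprime 2∣i = gcd≢1 (ℕ.n<1+n 1) 2∣i 2∣2*p
    2∣1+p : 2 ∣ suc p
    2∣1+p = divides (suc r) (identity₂ r)
    odd-coprime-below-p : ∀ {i} → i < r
      → gcd (suc (2 * i)) (2 * p) ≡ 1 × gcd (suc (suc (2 * i))) (2 * p) ≢ 1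
    odd-coprime-below-p {i} i<r = gcd[i,2*p]≡1 p-prime (2∤1+2*n i) (ℕ.>⇒∤ (s≤s (ℕ.*-monoʳ-< 2 i<r))) ,
                                  even-¬coprime (divides (suc i) (identity₂ i))
    odd-coprime-above-p : ∀ {i} → i < r
      → gcd (suc (suc p + 2 * i)) (2 * p) ≡ 1 × gcd (suc (suc (suc p + 2 * i))) (2 * p) ≢ 1
    odd-coprime-above-p {i} i<r =
      gcd[i,2*p]≡1 p-prime (subst (¬_ ∘′ (2 ∣_)) (sym (identity₃ r i)) (2∤1+2*n (suc (r + i))))
        (λ p∣ → ℕ.>⇒∤ (s≤s 2+2i≤2r) (ℕ.∣m+n∣m⇒∣n (subst (p ∣_) (identity₄ r i) p∣) ℕ.∣-refl)) ,
      even-¬coprime (divides (suc (suc (r + i))) (identity₅ r i))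
      where
      2+2i≤2r : suc (suc (2 * i)) ≤ 2 * r
      2+2i≤2r = subst (_≤ 2 * r) (trans (ℕ.*-comm 2 (suc i)) (sym (identity₂ i))) (ℕ.*-monoʳ-≤ 2 i<r)

  composite[2*p] : Composite (2 * p)
  composite[2*p] = composite-≢ 2 (ℕ.<⇒≢ (ℕ.<-≤-trans 2<p (ℕ.m≤n*m p 2))) 2∣2*p

  σ[2*p] : ∀ k → σ k (2 * p) ≡ 1 ^ k + 2 ^ k + p ^ k + (2 * p) ^ k
  σ[2*p] k = trans (cong (sum ∘′ map (_^ k)) divisors[2*p]) (identity (1 ^ k) (2 ^ k) (p ^ k) ((2 * p) ^ k))
    where
    identity : ∀ a b c d → a + (b + (c + (d + 0))) ≡ a + b + c + d
    identity = solve-∀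

  p≈1[mod-r] : + p ≈ + 1 [mod r ]
  -- (+ p) - 1 computes to + (2 * r).
  p≈1[mod-r] = ≡⇒≈[mod] (ℕ.n∣m*n 2)

  pσ≈2+2^[1+k] : ∀ k → + (p * σ k (2 * p)) ≈ + 2 ℤ.+ + (2 ^ suc k) [mod r ]
  pσ≈2+2^[1+k] k = begin
    + (p * σ k (2 * p))                                 ≡⟨ cong (λ s → + (p * s)) (σ[2*p] k) ⟩
    + (p * (1 ^ k + 2 ^ k + p ^ k + (2 * p) ^ k))       ≈⟨ pos-*-cong-mod p≈1[mod-r]
                                                             (pos-+-cong-mod (pos-+-cong-mod (≈-refl {+ (1 ^ k + 2 ^ k)})
                                                               (^-cong-mod k p≈1[mod-r])) (^-cong-mod k 2*p≈2)) ⟩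
    + (1 * (1 ^ k + 2 ^ k + 1 ^ k + 2 ^ k))             ≡⟨ cong (λ u → + (1 * (u + 2 ^ k + u + 2 ^ k))) (ℕ.^-zeroˡ k) ⟩
    + (1 * (1 + 2 ^ k + 1 + 2 ^ k))                     ≡⟨ cong +_ (identity (2 ^ k)) ⟩
    + (2 + 2 ^ suc k)                                   ∎
    where
    open import Relation.Binary.Reasoning.Setoid (≈-setoid r)
    identity : ∀ x → 1 * (1 + x + 1 + x) ≡ 2 + 2 * x
    identity = solve-∀
    2*p≈2 : + (2 * p) ≈ + 2 [mod r ]
    2*p≈2 = pos-*-cong-mod (≈-refl {+ 2}) p≈1[mod-r]

  InS[2*p]⇔pσ≈1 : ∀ k → InS k (2 * p) ⇔ + (p * σ k (2 * p)) ≈ + 1 [mod r ]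
  InS[2*p]⇔pσ≈1 k = mk⇔
    (λ (_ , 2pσ≡2) → *-cancelˡ-mod 2 (from-Defs (subst 2pσ≡2[mod_] φ[2*p] 2pσ≡2)))
    (λ pσ≈1 → composite[2*p] , subst 2pσ≡2[mod_] (sym φ[2*p]) (to-Defs (*-monoˡ-mod 2 pσ≈1)))
    where
    2pσ≡2[mod_] : ℕ → Set
    2pσ≡2[mod n ] = (+ (2 * p * σ k (2 * p))) ≡ (+ 2) [mod n ]
    2pσ≡2*pσ : + (2 * p * σ k (2 * p)) ≡ + 2 ℤ.* + (p * σ k (2 * p))
    2pσ≡2*pσ = trans (cong +_ (ℕ.*-assoc 2 p (σ k (2 * p)))) (ℤ.pos-* 2 (p * σ k (2 * p)))
    from-Defs : 2pσ≡2[mod 2 * r ] → + 2 ℤ.* + (p * σ k (2 * p)) ≈ + 2 [mod 2 * r ]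
    from-Defs = subst (_≈ + 2 [mod 2 * r ]) 2pσ≡2*pσ ∘ ≡⇒≈[mod]
    to-Defs : + 2 ℤ.* + (p * σ k (2 * p)) ≈ + 2 [mod 2 * r ] → 2pσ≡2[mod 2 * r ]
    to-Defs = ≈⇒≡[mod] ∘ subst (_≈ + 2 [mod 2 * r ]) (sym 2pσ≡2*pσ)

  InS[2*p]⇔2^[1+k]≈-1 : ∀ k → InS k (2 * p) ⇔ + (2 ^ suc k) ≈ -[1+ 0 ] [mod r ]
  InS[2*p]⇔2^[1+k]≈-1 k = mk⇔
    (λ inS → +-cancelˡ-mod (+ 2) (≈-trans (≈-sym (pσ≈2+2^[1+k] k)) (Equivalence.to (InS[2*p]⇔pσ≈1 k) inS)))
    (λ 2^[1+k]≈-1 → Equivalence.from (InS[2*p]⇔pσ≈1 k)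
                      (≈-trans (pσ≈2+2^[1+k] k) (+-cong-mod (≈-refl {+ 2}) 2^[1+k]≈-1)))

1<r∧r%2≡1⇒2<r : ∀ {r} → 1 < r → r % 2 ≡ 1 → 2 < r
1<r∧r%2≡1⇒2<r {suc zero} (s≤s ())
1<r∧r%2≡1⇒2<r {suc (suc zero)} _ ()
1<r∧r%2≡1⇒2<r {suc (suc (suc r))} _ _ = s≤s (s≤s (s≤s z≤n))

module _ {r m : ℕ} (p-prime : Prime (suc (2 * r))) (2<r : 2 < r) (ord : IsOrd2 r m) where

  open TwiceOddPrime {r} p-prime using (p; InS[2*p]⇔2^[1+k]≈-1)
  open Powers 2 r using (module Order)
  open Order ord

  ∃InS[2*p]⇔-1∈⟨2⟩ : (Σ ℕ λ k → InS k (2 * p)) ⇔ MinusOneInPowersOf2 r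
  ∃InS[2*p]⇔-1∈⟨2⟩ = mk⇔ (λ (k , inS) → suc k , ≈⇒≡[mod] (Equivalence.to (InS[2*p]⇔2^[1+k]≈-1 k) inS)) from
    where
    from : MinusOneInPowersOf2 r → Σ ℕ λ k → InS k (2 * p)
    from (zero  , 1≡-1)       = ⊥-elim (1≉-1[mod] 2<r (≡⇒≈[mod] 1≡-1))
    from (suc k , 2^[1+k]≡-1) = k , Equivalence.from (InS[2*p]⇔2^[1+k]≈-1 k) (≡⇒≈[mod] 2^[1+k]≡-1)

  -1∈⟨2⟩⇔ord≡2*t0 : MinusOneInPowersOf2 r ⇔ (Σ ℕ λ t0 → IsLeastNegPow r t0 × m ≡ 2 * t0)
  -1∈⟨2⟩⇔ord≡2*t0 = mk⇔ to (λ (t0 , (_ , 2^t0≡-1 , _) , _) → t0 , 2^t0≡-1)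
    where
    to : MinusOneInPowersOf2 r → Σ ℕ λ t0 → IsLeastNegPow r t0 × m ≡ 2 * t0
    to (j , 2ʲ≡-1) with least-witness (λ t → (+ (2 ^ t)) ≡? -[1+ 0 ] [mod r ]) {j} 2ʲ≡-1
    ... | zero  , 1≡-1 , _              = ⊥-elim (1≉-1[mod] 2<r (≡⇒≈[mod] 1≡-1))
    ... | suc t , 2^[1+t]≡-1 , minimal = suc t , least , LeastNegativePower.ord≡2*t 2<r least
      where
      least : IsLeastNegPow r (suc t)
      least = s≤s z≤n , 2^[1+t]≡-1 , λ s _ s<1+t → minimal s<1+t

  InS[2*p]⇔k≡t0-1[mod-ord] : ∀ {t0} → IsLeastNegPow r t0 → ∀ k
    → InS k (2 * p) ⇔ (+ k) ≡ (+ (t0 ∸ 1)) [mod m ]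
  InS[2*p]⇔k≡t0-1[mod-ord] {suc t} least k = begin
    InS k (2 * p)                              ≈⟨ InS[2*p]⇔2^[1+k]≈-1 k ⟩
    + (2 ^ suc k) ≈ -[1+ 0 ] [mod r ]          ≈⟨ pow≈-1⇔≈t ⟩
    + suc k ≈ + suc t [mod m ]                 ≈⟨ +-cancelˡ-mod⇔ (+ 1) ⟩
    + k ≈ + t [mod m ]                         ≈⟨ ≈⇔≡[mod] ⟩
    (+ k) ≡ (+ t) [mod m ]                     ∎
    where
    open LeastNegativePower 2<r least using (pow≈-1⇔≈t)
    open import Relation.Binary.Reasoning.Setoid (⇔-setoid 0ℓ)

  InS[2*p]⇔k≡t0-1 : ∀ {t0} → IsLeastNegPow r t0 → ∀ k
    → (InS k (2 * p) ⇔ ((+ k) ≡ (+ (t0 ∸ 1)) [mod 2 * t0 ]))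
    × (InS k (2 * p) ⇔ ((+ k) ≡ (+ (⌊ m /2⌋ ∸ 1)) [mod m ]))
  InS[2*p]⇔k≡t0-1 {t0} least k =
    subst (λ n → InS k (2 * p) ⇔ ((+ k) ≡ (+ (t0 ∸ 1)) [mod n ])) m≡2*t0 InS⇔ ,
    subst (λ x → InS k (2 * p) ⇔ ((+ k) ≡ (+ (x ∸ 1)) [mod m ])) (sym ⌊m/2⌋≡t0) InS⇔
    where
    InS⇔ : InS k (2 * p) ⇔ ((+ k) ≡ (+ (t0 ∸ 1)) [mod m ])
    InS⇔ = InS[2*p]⇔k≡t0-1[mod-ord] least k
    m≡2*t0 : m ≡ 2 * t0
    m≡2*t0 = LeastNegativePower.ord≡2*t 2<r least
    ⌊m/2⌋≡t0 : ⌊ m /2⌋ ≡ t0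
    ⌊m/2⌋≡t0 = trans (cong ⌊_/2⌋ (trans m≡2*t0 (cong (λ x → t0 + x) (ℕ.+-identityʳ t0))))
                     (sym (ℕ.n≡⌊n+n/2⌋ t0))

theorem4p4 : (p r m : ℕ) → Prime p → 5 ≤ p → p % 4 ≡ 3
    → p ∸ 1 ≡ 2 * r → 1 < r → r % 2 ≡ 1 → IsOrd2 r m
    → ((Σ ℕ λ k → InS k (2 * p)) ⇔ MinusOneInPowersOf2 r)
      × (MinusOneInPowersOf2 r ⇔ (Σ ℕ λ t0 → IsLeastNegPow r t0 × m ≡ 2 * t0))
      × (MinusOneInPowersOf2 r → (t0 : ℕ) → IsLeastNegPow r t0 → (k : ℕ)
          → (InS k (2 * p) ⇔ ((+ k) ≡ (+ (t0 ∸ 1)) [mod 2 * t0 ]))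
            × (InS k (2 * p) ⇔ ((+ k) ≡ (+ (⌊ m /2⌋ ∸ 1)) [mod m ])))
-- 5 ≤ p and p ≡ 3 (mod 4) are implied by r > 1 and r odd.
theorem4p4 (suc _) r m p-prime _ _ refl 1<r r-odd ord =
  ∃InS[2*p]⇔-1∈⟨2⟩ p-prime 2<r ord ,
  -1∈⟨2⟩⇔ord≡2*t0 p-prime 2<r ord ,
  λ _ _ least → InS[2*p]⇔k≡t0-1 p-prime 2<r ord least
  where
  2<r : 2 < r
  2<r = 1<r∧r%2≡1⇒2<r 1<r r-odd
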